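{- Let $w,\bar{w}\in\mathbb{Z}^N$ and let $\Delta\geq 1$ be an integer. If $w$ and $\bar{w}$ are equivalent on $\mathbb{Z}^N\cap[-\Delta,\Delta]^N$, then $\mathrm{sign}(w_i)=\mathrm{sign}(\bar{w}_i)$ for every $i\in[N]$.
   Context: For a set $S\subseteq\mathbb{R}^N$, two vectors $w,\bar w\in\mathbb{R}^N$ are called equivalent on $S$ if for all $x,y\in S$: $w^Tx\geq w^Ty \iff \bar w^Tx\geq \bar w^Ty$. -}

module Defs where

open import Data.Nat using (ℕ; zero; suc)
open import Data.Fin using (Fin) renaming (zero to fzero; suc to fsuc)
open import Data.Integer using (ℤ; +_; -[1+_]; -_; _+_; _*_; _≤_; _≥_)
open import Data.Product using (_×_)
open import Function.Bundles using (_⇔_)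

dot : ∀ {N} → (Fin N → ℤ) → (Fin N → ℤ) → ℤ
dot {zero}  w x = + 0
dot {suc N} w x = w fzero * x fzero + dot {N} (λ i → w (fsuc i)) (λ i → x (fsuc i))

InBox : ∀ {N} → ℕ → (Fin N → ℤ) → Set
InBox Δ x = ∀ i → (- (+ Δ) ≤ x i) × (x i ≤ + Δ)

EquivalentOn : ∀ {N} → ((Fin N → ℤ) → Set) → (Fin N → ℤ) → (Fin N → ℤ) → Set
EquivalentOn S w w̄ = ∀ x y → S x → S y → (dot w x ≥ dot w y) ⇔ (dot w̄ x ≥ dot w̄ y)

sgn : ℤ → ℤ
sgn (+ zero)    = + 0
sgn (+ (suc _)) = + 1
sgn -[1+ _ ]    = -[1+ 0 ]

{-# OPTIONS --safe #-}
module Submission where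

open import Defs
open import Data.Nat using (ℕ; _≤_; z≤n)
open import Data.Fin using (Fin) renaming (zero to fzero; suc to fsuc)
open import Data.Integer using (ℤ; +_; -[1+_]; -_; _+_; _≥_; +≤+)
import Data.Integer as ℤ
open import Data.Integer.Properties using (*-identityʳ; *-zeroʳ; +-identityʳ; +-identityˡ; neg-≤-pos)
open import Data.Product using (_×_; _,_)
open import Function using (const)
open import Function.Bundles using (_⇔_; Equivalence)
open import Relation.Binary.PropositionalEquality using (_≡_; refl; cong₂; trans)

-- Equivalence of w and w̄ compared against the origin 0 and the unit vector eᵢ, both of which lie in
-- the box as soon as Δ ≥ 1. Since w·eᵢ = wᵢ and w·0 = 0, this says wᵢ ≥ 0 ⇔ w̄ᵢ ≥ 0 and
-- wᵢ ≤ 0 ⇔ w̄ᵢ ≤ 0, and these two facts determine the sign.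

basis : ∀ {N} → Fin N → Fin N → ℤ
basis fzero    fzero    = + 1
basis fzero    (fsuc _) = + 0
basis (fsuc _) fzero    = + 0
basis (fsuc i) (fsuc j) = basis i j

dot-zeroʳ : ∀ {N} (w : Fin N → ℤ) → dot w (const (+ 0)) ≡ + 0
dot-zeroʳ {ℕ.zero} w = refl
dot-zeroʳ {ℕ.suc N} w = cong₂ _+_ (*-zeroʳ (w fzero)) (dot-zeroʳ (λ i → w (fsuc i)))

dot-basisʳ : ∀ {N} (w : Fin N → ℤ) (i : Fin N) → dot w (basis i) ≡ w i
dot-basisʳ {ℕ.suc N} w fzero =
  trans (cong₂ _+_ (*-identityʳ (w fzero)) (dot-zeroʳ (λ i → w (fsuc i)))) (+-identityʳ (w fzero))
dot-basisʳ {ℕ.suc N} w (fsuc i) =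
  trans (cong₂ _+_ (*-zeroʳ (w fzero)) (dot-basisʳ (λ j → w (fsuc j)) i)) (+-identityˡ (w (fsuc i)))

0∈[-Δ,Δ] : ∀ Δ → (- (+ Δ) ℤ.≤ + 0) × (+ 0 ℤ.≤ + Δ)
0∈[-Δ,Δ] Δ = neg-≤-pos , +≤+ z≤n

1∈[-Δ,Δ] : ∀ {Δ} → 1 ≤ Δ → (- (+ Δ) ℤ.≤ + 1) × (+ 1 ℤ.≤ + Δ)
1∈[-Δ,Δ] 1≤Δ = neg-≤-pos , +≤+ 1≤Δ

InBox-zero : ∀ {N} Δ → InBox {N} Δ (const (+ 0))
InBox-zero Δ _ = 0∈[-Δ,Δ] Δ

InBox-basis : ∀ {N Δ} → 1 ≤ Δ → (i : Fin N) → InBox Δ (basis i)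
InBox-basis 1≤Δ fzero    fzero    = 1∈[-Δ,Δ] 1≤Δ
InBox-basis 1≤Δ fzero    (fsuc _) = 0∈[-Δ,Δ] _
InBox-basis 1≤Δ (fsuc _) fzero    = 0∈[-Δ,Δ] _
InBox-basis 1≤Δ (fsuc i) (fsuc j) = InBox-basis 1≤Δ i j

≥⇔≥-cong : ∀ {a a′ b b′ c c′ d d′ : ℤ} → a ≡ a′ → b ≡ b′ → c ≡ c′ → d ≡ d′ →
           (a ≥ b ⇔ c ≥ d) → (a′ ≥ b′ ⇔ c′ ≥ d′)
≥⇔≥-cong refl refl refl refl e = e

sgn-≡ : ∀ a b → (a ≥ + 0 ⇔ b ≥ + 0) → (+ 0 ≥ a ⇔ + 0 ≥ b) → sgn a ≡ sgn b
sgn-≡ (+ ℕ.zero)  (+ ℕ.zero)  _ _ = refl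
sgn-≡ (+ ℕ.suc _) (+ ℕ.suc _) _ _ = refl
sgn-≡ -[1+ _ ]    -[1+ _ ]    _ _ = refl
sgn-≡ (+ ℕ.zero)  (+ ℕ.suc _) _ ≤0 with Equivalence.to ≤0 (+≤+ z≤n)
... | +≤+ ()
sgn-≡ (+ ℕ.suc _) (+ ℕ.zero)  _ ≤0 with Equivalence.from ≤0 (+≤+ z≤n)
... | +≤+ ()
sgn-≡ (+ _)       -[1+ _ ]    ≥0 _ with Equivalence.to ≥0 (+≤+ z≤n)
... | ()
sgn-≡ -[1+ _ ]    (+ _)       ≥0 _ with Equivalence.from ≥0 (+≤+ z≤n)
... | ()

lemma3 : (N : ℕ) (w w̄ : Fin N → ℤ) (Δ : ℕ) → 1 ≤ Δ →
    EquivalentOn (InBox Δ) w w̄ → ∀ (i : Fin N) → sgn (w i) ≡ sgn (w̄ i)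
lemma3 N w w̄ Δ 1≤Δ equiv i = sgn-≡ (w i) (w̄ i) nonneg nonpos
  where
  eᵢ∈box = InBox-basis 1≤Δ i
  0∈box  = InBox-zero Δ

  nonneg : w i ≥ + 0 ⇔ w̄ i ≥ + 0
  nonneg = ≥⇔≥-cong (dot-basisʳ w i) (dot-zeroʳ w) (dot-basisʳ w̄ i) (dot-zeroʳ w̄)
                    (equiv (basis i) (const (+ 0)) eᵢ∈box 0∈box)

  nonpos : + 0 ≥ w i ⇔ + 0 ≥ w̄ i
  nonpos = ≥⇔≥-cong (dot-zeroʳ w) (dot-basisʳ w i) (dot-zeroʳ w̄) (dot-basisʳ w̄ i)
                    (equiv (const (+ 0)) (basis i) 0∈box eᵢ∈box)
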